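{- Let $n \ge 2$. Among all connected bipartite graphs on $n$ vertices, the balanced complete bipartite graph $K_{\lfloor n/2\rfloor, \lceil n/2\rceil}$ attains the maximum weighted Szeged index; that is, $wSz(G) \le wSz(K_{\lfloor n/2\rfloor, \lceil n/2\rceil})$ for every connected bipartite graph $G$ on $n$ vertices.
   Context: For a connected simple graph $G$ and an edge $e = uv \in E(G)$, let $n_u(e)$ denote the number of vertices $x \in V(G)$ with $d(x,u) < d(x,v)$, where $d$ is the shortest-path distance in $G$ (and similarly $n_v(e)$). The weighted Szeged index of $G$ is $$wSz(G) = \sum_{e = uv \in E(G)} \big(\deg(u) + \deg(v)\big)\, n_u(e)\, n_v(e),$$ where $\deg(u)$ is the degree of $u$. -}

module Defs where

open import Data.Nat using (ℕ; zero; suc; _+_; _*_; _<ᵇ_; _/_)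
open import Data.Bool using (Bool; true; false; _∧_; _∨_; _xor_; if_then_else_; not)
open import Data.Fin using (Fin; toℕ; _≟_)
open import Data.List using (List; map; allFin; length; filterᵇ)
open import Data.Nat.ListAction using (sum)
open import Data.Bool.ListAction using (any)
open import Relation.Nullary.Decidable using (⌊_⌋)
open import Relation.Binary.PropositionalEquality using (_≡_; _≢_; refl)
open import Data.Product using (∃)

record Graph (n : ℕ) : Set where
  field
    adj    : Fin n → Fin n → Bool
    sym    : ∀ i j → adj i j ≡ adj j i
    irrefl : ∀ i → adj i i ≡ false
open Graph public

module _ {n : ℕ} (G : Graph n) where

  data Walk : Fin n → Fin n → Set where
    nil  : ∀ {x} → Walk x x
    cons : ∀ {x y z} → adj G x y ≡ true → Walk y z → Walk x z

  Connected : Set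
  Connected = ∀ x y → Walk x y

  Bipartite : Set
  Bipartite = ∃ λ (c : Fin n → Bool) → ∀ i j → adj G i j ≡ true → c i ≢ c j

  reach : ℕ → Fin n → Fin n → Bool
  reach zero    x y = ⌊ x ≟ y ⌋
  reach (suc k) x y = reach k x y ∨ any (λ z → reach k x z ∧ adj G z y) (allFin n)

-- least k < b with p k, or b if there is none
least : (ℕ → Bool) → ℕ → ℕ
least p zero    = zero
least p (suc b) = if p zero then zero else suc (least (λ k → p (suc k)) b)

module _ {n : ℕ} (G : Graph n) where

  -- shortest-path distance (the least k with a walk of length ≤ k);
  -- in a connected graph on n vertices this is always < n.
  dist : Fin n → Fin n → ℕ
  dist x y = least (λ k → reach G k x y) n

  count : (Fin n → Bool) → ℕ
  count p = length (filterᵇ p (allFin n))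

  deg : Fin n → ℕ
  deg u = count (adj G u)

  nClose : Fin n → Fin n → ℕ
  nClose u v = count (λ x → dist x u <ᵇ dist x v)

  -- weighted Szeged index; each edge {u,v} counted once (toℕ u < toℕ v)
  wSz : ℕ
  wSz = sum (map (λ u → sum (map (λ v →
          if adj G u v ∧ (toℕ u <ᵇ toℕ v)
          then (deg u + deg v) * nClose u v * nClose v u
          else 0) (allFin n))) (allFin n))

-- balanced complete bipartite graph K_{⌊n/2⌋,⌈n/2⌉} on Fin n:
-- parts {i | i < ⌊n/2⌋} and {i | i ≥ ⌊n/2⌋}
side : (n : ℕ) → Fin n → Bool
side n i = toℕ i <ᵇ (n / 2)

xor-self : ∀ b → (b xor b) ≡ false
xor-self true = refl
xor-self false = refl

xor-comm : ∀ a b → (a xor b) ≡ (b xor a)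
xor-comm true true = refl
xor-comm true false = refl
xor-comm false true = refl
xor-comm false false = refl

Kbal : (n : ℕ) → Graph n
Kbal n = record
  { adj    = λ i j → side n i xor side n j
  ; sym    = λ i j → xor-comm (side n i) (side n j)
  ; irrefl = λ i → xor-self (side n i)
  }

-- Let c be a proper 2-colouring of G, with colour classes of sizes a + b = n, and let
-- M = ⌊n/2⌋⌈n/2⌉, the largest product of two naturals with sum at most n. Every edge uv
-- joins the two classes, so deg u + deg v ≤ a + b = n; and n_u(uv) + n_v(uv) ≤ n gives
-- n_u(uv) n_v(uv) ≤ M. Since G has at most ab ≤ M edges, wSz(G) ≤ n M².
-- In K = K_{⌊n/2⌋,⌈n/2⌉}, each of the M edges uv has deg u + deg v = n and
-- n_u(uv) ≥ deg u (u itself and every neighbour of u other than v are closer to u),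
-- so wSz(K) ≥ n M².
module Submission where

open import Defs hiding (sym)

open import Data.Bool using (Bool; true; false; T; not; _∧_; _xor_; if_then_else_)
open import Data.Bool.Properties using (∧-identityʳ; ∧-zeroʳ; T-∧; T-∨; T-≡)
open import Data.Fin using (Fin; zero; suc; toℕ; _≟_)
open import Data.List using (map; allFin; length; filterᵇ; tabulate)
open import Data.List.Membership.Propositional using (lose)
open import Data.List.Membership.Propositional.Properties using (∈-allFin)
open import Data.List.Relation.Unary.Any using (satisfied)
open import Data.List.Relation.Unary.Any.Properties using (any⁺; any⁻)
open import Data.Nat using (ℕ; zero; suc; _+_; _*_; _∸_; _/_; _%_; _≤_; _<_; _<ᵇ_; _≤?_; z≤n; s≤s; z<s; s<s)
open import Data.Nat.DivMod using (m≡m%n+[m/n]*n; m%n<n; m/n≤m)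
import Data.Nat.ListAction as List
open import Data.Nat.Properties hiding (_≟_)
open import Data.Nat.Tactic.RingSolver using (solve-∀)
open import Data.Product using (_,_)
open import Data.Sum using (inj₁; inj₂)
open import Function using (_∘_; id)
open import Function.Bundles using (module Equivalence)
open import Relation.Binary.PropositionalEquality
open import Relation.Nullary using (¬_; contradiction)
open import Relation.Nullary.Decidable using (⌊_⌋; yes; no; fromWitness; toWitness; fromWitnessFalse)

open import Algebra.Properties.Semiring.Sum +-*-semiring
  using (sum; sum-syntax; sum-cong-≗; sum-replicate-zero; *-distribˡ-sum)

sum-mono-≤ : ∀ {n} {f g : Fin n → ℕ} → (∀ i → f i ≤ g i) → sum f ≤ sum g
sum-mono-≤ {zero}  f≤g = z≤n
sum-mono-≤ {suc n} f≤g = +-mono-≤ (f≤g zero) (sum-mono-≤ (f≤g ∘ suc))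

iverson : Bool → ℕ
iverson b = if b then 1 else 0

card : ∀ {n} → (Fin n → Bool) → ℕ
card p = sum (iverson ∘ p)

_∖_ : ∀ {n} → (Fin n → Bool) → Fin n → (Fin n → Bool)
(p ∖ w) x = p x ∧ not ⌊ x ≟ w ⌋

sum-map-tabulate : ∀ {A : Set} {n} (g : A → ℕ) (f : Fin n → A) →
                   List.sum (map g (tabulate f)) ≡ sum (g ∘ f)
sum-map-tabulate {n = zero}  g f = refl
sum-map-tabulate {n = suc n} g f = cong (g (f zero) +_) (sum-map-tabulate g (f ∘ suc))

length-filterᵇ-tabulate : ∀ {A : Set} {n} (p : A → Bool) (f : Fin n → A) →
                          length (filterᵇ p (tabulate f)) ≡ card (p ∘ f)
length-filterᵇ-tabulate {n = zero}  p f = refl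
length-filterᵇ-tabulate {n = suc n} p f with p (f zero)
... | true  = cong suc (length-filterᵇ-tabulate p (f ∘ suc))
... | false = length-filterᵇ-tabulate p (f ∘ suc)

count≡card : ∀ {n} (G : Graph n) p → count G p ≡ card p
count≡card G p = length-filterᵇ-tabulate p id

card-mono : ∀ {n} {p q : Fin n → Bool} → (∀ x → p x ≡ true → q x ≡ true) → card p ≤ card q
card-mono {p = p} {q} p⇒q = sum-mono-≤ iverson-mono
  where
  iverson-mono : ∀ x → iverson (p x) ≤ iverson (q x)
  iverson-mono x with p x | p⇒q x
  ... | false | _   = z≤n
  ... | true  | p⇒q rewrite p⇒q refl = ≤-refl

card-cong : ∀ {n} {p q : Fin n → Bool} → (∀ x → p x ≡ q x) → card p ≡ card q
card-cong p≗q = sum-cong-≗ (cong iverson ∘ p≗q)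

card+card-not : ∀ {n} (p : Fin n → Bool) → card p + card (not ∘ p) ≡ n
card+card-not {zero}  p = refl
card+card-not {suc n} p with p zero
... | true  = cong suc (card+card-not (p ∘ suc))
... | false = trans (+-suc (card (p ∘ suc)) _) (cong suc (card+card-not (p ∘ suc)))

card-disjoint : ∀ {n} {p q : Fin n → Bool} → (∀ x → q x ≡ true → p x ≡ false) → card p + card q ≤ n
card-disjoint {n} {p} {q} q⇒¬p = begin
  card p + card q         ≤⟨ +-monoʳ-≤ (card p) (card-mono q⇒not-p) ⟩
  card p + card (not ∘ p) ≡⟨ card+card-not p ⟩
  n                       ∎
  where
  open ≤-Reasoning
  q⇒not-p : ∀ x → q x ≡ true → not (p x) ≡ true
  q⇒not-p x qx rewrite q⇒¬p x qx = refl

⌊suc≟suc⌋ : ∀ {n} (x y : Fin n) → ⌊ suc x ≟ suc y ⌋ ≡ ⌊ x ≟ y ⌋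
⌊suc≟suc⌋ x y with x ≟ y
... | yes _ = refl
... | no  _ = refl

card-∖ : ∀ {n} {p : Fin n → Bool} {w} → p w ≡ true → card p ≡ suc (card (p ∖ w))
card-∖ {suc n} {p} {zero} pw rewrite pw =
  cong suc (card-cong λ x → sym (∧-identityʳ (p (suc x))))
card-∖ {suc n} {p} {suc w} pw = begin
  iverson (p zero) + card p′                    ≡⟨ cong (iverson (p zero) +_) (card-∖ {p = p′} pw) ⟩
  iverson (p zero) + suc (card (p′ ∖ w))        ≡⟨ +-suc (iverson (p zero)) _ ⟩
  suc (iverson (p zero) + card (p′ ∖ w))        ≡⟨ cong₂ (λ b m → 1 + (iverson b + m)) (∧-identityʳ (p zero)) tail ⟨
  suc (card (p ∖ suc w))                        ∎
  where
  open ≡-Reasoning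
  p′ : Fin n → Bool
  p′ x = p (suc x)
  tail : card (λ x → (p ∖ suc w) (suc x)) ≡ card (p′ ∖ w)
  tail = card-cong λ x → cong (λ b → p′ x ∧ not b) (⌊suc≟suc⌋ x w)

xor-≢ : ∀ {a b} → a ≢ b → (a xor b) ≡ true
xor-≢ {true}  {true}  a≢b = contradiction refl a≢b
xor-≢ {true}  {false} _   = refl
xor-≢ {false} {true}  _   = refl
xor-≢ {false} {false} a≢b = contradiction refl a≢b

xor-true⇒≢ : ∀ a b → (a xor b) ≡ true → a ≢ b
xor-true⇒≢ true  _ () refl
xor-true⇒≢ false _ () refl

xor-true-cancel : ∀ a b c → (a xor b) ≡ true → (a xor c) ≡ true → (b xor c) ≡ false
xor-true-cancel true  false false _ _ = refl
xor-true-cancel false true  true  _ _ = refl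

card-xor+card-xor : ∀ {n} a b → (a xor b) ≡ true → (f : Fin n → Bool) →
                    card (λ x → a xor f x) + card (λ x → b xor f x) ≡ n
card-xor+card-xor true  false _ f = trans (+-comm (card (not ∘ f)) (card f)) (card+card-not f)
card-xor+card-xor false true  _ f = card+card-not f

card-xor*card-xor : ∀ {n} a b → (a xor b) ≡ true → (f : Fin n → Bool) →
                    card (λ x → a xor f x) * card (λ x → b xor f x) ≡ card f * card (not ∘ f)
card-xor*card-xor true  false _ f = *-comm (card (not ∘ f)) (card f)
card-xor*card-xor false true  _ f = refl

crosses : ∀ {n} → (Fin n → Bool) → Fin n → Fin n → Bool
crosses c u v = c u xor c v

pairCount : ∀ {n} → (Fin n → Fin n → Bool) → ℕ
pairCount {n} R = ∑[ u < n ] ∑[ v < n ] iverson (R u v ∧ (toℕ u <ᵇ toℕ v))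

pairCount-suc : ∀ {n} (R : Fin (suc n) → Fin (suc n) → Bool) →
                pairCount R ≡ card (λ v → R zero (suc v)) + pairCount (λ u v → R (suc u) (suc v))
pairCount-suc R = cong₂ _+_
  (cong₂ _+_ (cong iverson (∧-zeroʳ (R zero zero))) (card-cong λ v → ∧-identityʳ (R zero (suc v))))
  (sum-cong-≗ λ u → cong (λ b → iverson b + later u) (∧-zeroʳ (R (suc u) zero)))
  where
  later : ∀ u → ℕ
  later u = card (λ v → R (suc u) (suc v) ∧ (toℕ u <ᵇ toℕ v))

pairCount-crosses : ∀ {n} (c : Fin n → Bool) → pairCount (crosses c) ≡ card c * card (not ∘ c)
pairCount-crosses {zero}  c = refl
pairCount-crosses {suc n} c
  rewrite pairCount-suc (crosses c) | pairCount-crosses (λ x → c (suc x)) with c zero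
... | true  = refl
... | false = sym (*-suc (card (λ x → c (suc x))) (card (λ x → not (c (suc x)))))

card-<ᵇ : ∀ {n} m → m ≤ n → card {n} (λ i → toℕ i <ᵇ m) ≡ m
card-<ᵇ {n}     zero    _         = sum-replicate-zero n
card-<ᵇ {suc n} (suc m) (s≤s m≤n) = cong suc (card-<ᵇ m m≤n)

card-side : ∀ n → card (side n) ≡ n / 2
card-side n = card-<ᵇ (n / 2) (m/n≤m n 2)

card-not-side : ∀ n → card (not ∘ side n) ≡ n ∸ n / 2
card-not-side n = begin
  card (not ∘ side n)                                 ≡⟨ m+n∸m≡n (card (side n)) _ ⟨
  card (side n) + card (not ∘ side n) ∸ card (side n) ≡⟨ cong₂ _∸_ (card+card-not (side n)) (card-side n) ⟩
  n ∸ n / 2                                           ∎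
  where open ≡-Reasoning

maxProduct : ℕ → ℕ
maxProduct n = n / 2 * (n ∸ n / 2)

*-≤-of-+-≤ : ∀ {x y a b} → x ≤ a → x ≤ b → x + y ≤ a + b → x * y ≤ a * b
*-≤-of-+-≤ {x} {y} {a} {b} x≤a x≤b x+y≤a+b = begin
  x * y         ≤⟨ *-monoʳ-≤ x y≤b+d ⟩
  x * (b + d)   ≡⟨ *-distribˡ-+ x b d ⟩
  x * b + x * d ≤⟨ +-monoʳ-≤ (x * b) (*-monoˡ-≤ d x≤b) ⟩
  x * b + b * d ≡⟨ cong (x * b +_) (*-comm b d) ⟩
  x * b + d * b ≡⟨ *-distribʳ-+ b x d ⟨
  (x + d) * b   ≡⟨ cong (_* b) (m+[n∸m]≡n x≤a) ⟩
  a * b         ∎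
  where
  open ≤-Reasoning
  d = a ∸ x
  y≤b+d : y ≤ b + d
  y≤b+d = +-cancelˡ-≤ x y (b + d) (begin
    x + y       ≤⟨ x+y≤a+b ⟩
    a + b       ≡⟨ cong (_+ b) (m+[n∸m]≡n x≤a) ⟨
    x + d + b   ≡⟨ +-assoc x d b ⟩
    x + (d + b) ≡⟨ cong (x +_) (+-comm d b) ⟩
    x + (b + d) ∎)

*-≤-balanced : ∀ {x y a b} → a ≤ b → b ≤ suc a → x + y ≤ a + b → x * y ≤ a * b
*-≤-balanced {x} {y} {a} {b} a≤b b≤1+a x+y≤a+b with x ≤? a
... | yes x≤a = *-≤-of-+-≤ x≤a (≤-trans x≤a a≤b) x+y≤a+b
... | no  x≰a = begin
  x * y ≡⟨ *-comm x y ⟩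
  y * x ≤⟨ *-≤-of-+-≤ y≤a (≤-trans y≤a a≤b) (≤-trans (≤-reflexive (+-comm y x)) x+y≤a+b) ⟩
  a * b ∎
  where
  open ≤-Reasoning
  y≤a : y ≤ a
  y≤a = +-cancelˡ-≤ a y a (≤-pred (begin
    suc (a + y) ≤⟨ +-monoˡ-≤ y (≰⇒> x≰a) ⟩
    x + y       ≤⟨ x+y≤a+b ⟩
    a + b       ≤⟨ +-monoʳ-≤ a b≤1+a ⟩
    a + suc a   ≡⟨ +-suc a a ⟩
    suc (a + a) ∎))

n∸n/2≡n%2+n/2 : ∀ n → n ∸ n / 2 ≡ n % 2 + n / 2
n∸n/2≡n%2+n/2 n = begin
  n ∸ n / 2                     ≡⟨ cong (_∸ n / 2) (m≡m%n+[m/n]*n n 2) ⟩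
  n % 2 + n / 2 * 2 ∸ n / 2     ≡⟨ cong (_∸ n / 2) (regroup (n % 2) (n / 2)) ⟩
  n % 2 + n / 2 + n / 2 ∸ n / 2 ≡⟨ m+n∸n≡m (n % 2 + n / 2) (n / 2) ⟩
  n % 2 + n / 2                 ∎
  where
  open ≡-Reasoning
  regroup : ∀ r q → r + q * 2 ≡ r + q + q
  regroup = solve-∀

*-≤-maxProduct : ∀ {n} x y → x + y ≤ n → x * y ≤ maxProduct n
*-≤-maxProduct {n} x y x+y≤n = *-≤-balanced {x} {y} half≤rest rest≤1+half (begin
  x + y               ≤⟨ x+y≤n ⟩
  n                   ≡⟨ m+[n∸m]≡n (m/n≤m n 2) ⟨
  n / 2 + (n ∸ n / 2) ∎)
  where
  open ≤-Reasoning
  half≤rest : n / 2 ≤ n ∸ n / 2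
  half≤rest = ≤-trans (m≤n+m (n / 2) (n % 2)) (≤-reflexive (sym (n∸n/2≡n%2+n/2 n)))
  rest≤1+half : n ∸ n / 2 ≤ suc (n / 2)
  rest≤1+half = ≤-trans (≤-reflexive (n∸n/2≡n%2+n/2 n)) (+-monoˡ-≤ (n / 2) (≤-pred (m%n<n n 2)))

least-≤ : ∀ {p : ℕ → Bool} b {k} → T (p k) → least p b ≤ k
least-≤             zero    _  = z≤n
least-≤ {p} (suc b) {zero}  pk with p zero | pk
... | true  | _ = z≤n
least-≤ {p} (suc b) {suc k} pk with p zero
... | true  = z≤n
... | false = s≤s (least-≤ b pk)

≤-least : ∀ {p : ℕ → Bool} {b j} → (∀ {i} → i < j → ¬ T (p i)) → j ≤ b → j ≤ least p b
≤-least {j = zero} _ _ = z≤n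
≤-least {p} {suc b} {suc j} none (s≤s j≤b) with p zero | none {zero} z<s
... | true  | ¬p0 = contradiction _ ¬p0
... | false | _   = s≤s (≤-least (λ i<j → none (s<s i<j)) j≤b)

module _ {n} (G : Graph n) where

  reach-refl : ∀ x → T (reach G 0 x x)
  reach-refl x = fromWitness refl

  reach-adj : ∀ {x y} → adj G x y ≡ true → T (reach G 1 x y)
  reach-adj {x} {y} xy = Equivalence.from T-∨ (inj₂ (any⁺ _ (lose (∈-allFin x) x→y)))
    where
    x→y : T (⌊ x ≟ x ⌋ ∧ adj G x y)
    x→y = Equivalence.from T-∧ (fromWitness refl , Equivalence.from T-≡ xy)

  ¬reach-0 : ∀ {x y} → x ≢ y → ¬ T (reach G 0 x y)
  ¬reach-0 x≢y = x≢y ∘ toWitness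

  ¬reach-1 : ∀ {x y} → x ≢ y → adj G x y ≡ false → ¬ T (reach G 1 x y)
  ¬reach-1 {x} {y} x≢y ¬xy r with Equivalence.to T-∨ r
  ... | inj₁ r₀   = ¬reach-0 x≢y r₀
  ... | inj₂ step with satisfied (any⁻ _ (allFin n) step)
  ...   | z , x→z→y with Equivalence.to T-∧ x→z→y
  ...     | x→z , z→y with toWitness {a? = x ≟ z} x→z
  ...       | refl = subst T ¬xy z→y

  dist-self : ∀ x → dist G x x ≡ 0
  dist-self x = n≤0⇒n≡0 (least-≤ n (reach-refl x))

  adj⇒dist≤1 : ∀ {x y} → adj G x y ≡ true → dist G x y ≤ 1
  adj⇒dist≤1 xy = least-≤ n (reach-adj xy)

  ≢⇒0<dist : ∀ {x y} → 1 ≤ n → x ≢ y → 0 < dist G x y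
  ≢⇒0<dist 1≤n x≢y = ≤-least (λ { z<s → ¬reach-0 x≢y }) 1≤n

  ¬adj⇒1<dist : ∀ {x y} → 2 ≤ n → x ≢ y → adj G x y ≡ false → 1 < dist G x y
  ¬adj⇒1<dist 2≤n x≢y ¬xy = ≤-least (λ { z<s → ¬reach-0 x≢y ; (s<s z<s) → ¬reach-1 x≢y ¬xy }) 2≤n

<ᵇ-asym : ∀ m n → (m <ᵇ n) ≡ true → (n <ᵇ m) ≡ false
<ᵇ-asym zero    (suc n) _   = refl
<ᵇ-asym (suc m) (suc n) m<n = <ᵇ-asym m n m<n

nClose+nClose≤n : ∀ {n} (G : Graph n) u v → nClose G u v + nClose G v u ≤ n
nClose+nClose≤n G u v rewrite count≡card G (λ x → dist G x u <ᵇ dist G x v)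
                            | count≡card G (λ x → dist G x v <ᵇ dist G x u)
  = card-disjoint λ x → <ᵇ-asym (dist G x v) (dist G x u)

edgeWeight : ∀ {n} → Graph n → Fin n → Fin n → ℕ
edgeWeight G u v = (deg G u + deg G v) * nClose G u v * nClose G v u

module _ {n} (G : Graph n) {c : Fin n → Bool} (proper : ∀ i j → adj G i j ≡ true → c i ≢ c j) where

  adj⇒crosses : ∀ u v → adj G u v ≡ true → crosses c u v ≡ true
  adj⇒crosses u v uv = xor-≢ (proper u v uv)

  deg≤card-opposite : ∀ u → deg G u ≤ card (crosses c u)
  deg≤card-opposite u rewrite count≡card G (adj G u) = card-mono (adj⇒crosses u)

  edgeWeight≤ : ∀ u v → adj G u v ≡ true → edgeWeight G u v ≤ n * maxProduct n
  edgeWeight≤ u v uv = begin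
    (deg G u + deg G v) * nClose G u v * nClose G v u   ≡⟨ *-assoc (deg G u + deg G v) _ _ ⟩
    (deg G u + deg G v) * (nClose G u v * nClose G v u) ≤⟨ *-mono-≤ deg+deg≤n nClose*nClose≤M ⟩
    n * maxProduct n                                    ∎
    where
    open ≤-Reasoning
    deg+deg≤n : deg G u + deg G v ≤ n
    deg+deg≤n = begin
      deg G u + deg G v                       ≤⟨ +-mono-≤ (deg≤card-opposite u) (deg≤card-opposite v) ⟩
      card (crosses c u) + card (crosses c v) ≡⟨ card-xor+card-xor (c u) (c v) (adj⇒crosses u v uv) c ⟩
      n                                       ∎
    nClose*nClose≤M : nClose G u v * nClose G v u ≤ maxProduct n
    nClose*nClose≤M = *-≤-maxProduct (nClose G u v) (nClose G v u) (nClose+nClose≤n G u v)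

card-side*card-not-side : ∀ n → card (side n) * card (not ∘ side n) ≡ maxProduct n
card-side*card-not-side n = cong₂ _*_ (card-side n) (card-not-side n)

pairCount-Kbal : ∀ n → pairCount (adj (Kbal n)) ≡ maxProduct n
pairCount-Kbal n = trans (pairCount-crosses (side n)) (card-side*card-not-side n)

module _ (n : ℕ) where

  private
    K = Kbal n
    s = side n

  deg-Kbal : ∀ u → deg K u ≡ card (crosses s u)
  deg-Kbal u = count≡card K (crosses s u)

  deg+deg-Kbal : ∀ {u v} → adj K u v ≡ true → deg K u + deg K v ≡ n
  deg+deg-Kbal {u} {v} uv = trans (cong₂ _+_ (deg-Kbal u) (deg-Kbal v)) (card-xor+card-xor (s u) (s v) uv s)

  deg*deg-Kbal : ∀ {u v} → adj K u v ≡ true → deg K u * deg K v ≡ maxProduct n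
  deg*deg-Kbal {u} {v} uv = begin
    deg K u * deg K v                       ≡⟨ cong₂ _*_ (deg-Kbal u) (deg-Kbal v) ⟩
    card (crosses s u) * card (crosses s v) ≡⟨ card-xor*card-xor (s u) (s v) uv s ⟩
    card s * card (not ∘ s)                 ≡⟨ card-side*card-not-side n ⟩
    maxProduct n                            ∎
    where open ≡-Reasoning

  deg≤nClose-Kbal : 2 ≤ n → ∀ {u v} → adj K u v ≡ true → deg K u ≤ nClose K u v
  deg≤nClose-Kbal 2≤n {u} {v} uv = begin
    deg K u                       ≡⟨ deg-Kbal u ⟩
    card (crosses s u)            ≡⟨ card-∖ {p = crosses s u} uv ⟩
    suc (card (crosses s u ∖ v))  ≤⟨ s≤s (card-mono opposite⇒closer) ⟩
    suc (card (closer-to-u ∖ u))  ≡⟨ card-∖ {p = closer-to-u} u-closer ⟨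
    card closer-to-u              ≡⟨ count≡card K closer-to-u ⟨
    nClose K u v                  ∎
    where
    open ≤-Reasoning
    closer-to-u : Fin n → Bool
    closer-to-u x = dist K x u <ᵇ dist K x v
    u≢v : u ≢ v
    u≢v refl = xor-true⇒≢ (s u) (s u) uv refl
    u-closer : closer-to-u u ≡ true
    u-closer rewrite dist-self K u = Equivalence.to T-≡ (<⇒<ᵇ (≢⇒0<dist K (≤-trans (s≤s z≤n) 2≤n) u≢v))
    opposite⇒closer : ∀ x → (crosses s u ∖ v) x ≡ true → (closer-to-u ∖ u) x ≡ true
    opposite⇒closer x h with s u xor s x in ux | x ≟ v
    opposite⇒closer x () | false | _
    opposite⇒closer x () | true  | yes _
    ... | true | no x≢v =
      cong₂ _∧_ (Equivalence.to T-≡ (<⇒<ᵇ x-closer)) (Equivalence.to T-≡ (fromWitnessFalse x≢u))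
      where
      x≢u : x ≢ u
      x≢u refl = xor-true⇒≢ (s u) (s u) ux refl
      x-closer : dist K x u < dist K x v
      x-closer = ≤-<-trans (adj⇒dist≤1 K (trans (xor-comm (s x) (s u)) ux))
                           (¬adj⇒1<dist K 2≤n x≢v (xor-true-cancel (s u) (s x) (s v) ux uv))

  edgeWeight-Kbal≥ : 2 ≤ n → ∀ u v → adj K u v ≡ true → n * maxProduct n ≤ edgeWeight K u v
  edgeWeight-Kbal≥ 2≤n u v uv = begin
    n * maxProduct n                                    ≡⟨ cong₂ _*_ (deg+deg-Kbal uv) (deg*deg-Kbal uv) ⟨
    (deg K u + deg K v) * (deg K u * deg K v)           ≤⟨ *-monoʳ-≤ (deg K u + deg K v) deg*deg≤nClose*nClose ⟩
    (deg K u + deg K v) * (nClose K u v * nClose K v u) ≡⟨ *-assoc (deg K u + deg K v) _ _ ⟨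
    edgeWeight K u v                                    ∎
    where
    open ≤-Reasoning
    vu : adj K v u ≡ true
    vu = trans (Graph.sym K v u) uv
    deg*deg≤nClose*nClose : deg K u * deg K v ≤ nClose K u v * nClose K v u
    deg*deg≤nClose*nClose = *-mono-≤ (deg≤nClose-Kbal 2≤n uv) (deg≤nClose-Kbal 2≤n vu)

edgeSum : ∀ {n} → (Fin n → Fin n → Bool) → (Fin n → Fin n → ℕ) → ℕ
edgeSum {n} R w = ∑[ u < n ] ∑[ v < n ] (if R u v ∧ (toℕ u <ᵇ toℕ v) then w u v else 0)

wSz≡edgeSum : ∀ {n} (G : Graph n) → wSz G ≡ edgeSum (adj G) (edgeWeight G)
wSz≡edgeSum {n} G =
  trans (sum-map-tabulate (λ u → List.sum (map (term u) (allFin n))) id)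
        (sum-cong-≗ λ u → sum-map-tabulate (term u) id)
  where
  term : Fin n → Fin n → ℕ
  term u v = if adj G u v ∧ (toℕ u <ᵇ toℕ v) then edgeWeight G u v else 0

*-pairCount : ∀ {n} k (R : Fin n → Fin n → Bool) →
              k * pairCount R ≡ ∑[ u < n ] ∑[ v < n ] (k * iverson (R u v ∧ (toℕ u <ᵇ toℕ v)))
*-pairCount {n} k R =
  trans (*-distribˡ-sum k (λ u → sum (pair u))) (sum-cong-≗ λ u → *-distribˡ-sum k (pair u))
  where
  pair : Fin n → Fin n → ℕ
  pair u v = iverson (R u v ∧ (toℕ u <ᵇ toℕ v))

edgeSum-≤ : ∀ {n} {R S : Fin n → Fin n → Bool} {w k} →
            (∀ u v → R u v ≡ true → S u v ≡ true) → (∀ u v → R u v ≡ true → w u v ≤ k) →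
            edgeSum R w ≤ k * pairCount S
edgeSum-≤ {R = R} {S} {w} {k} R⇒S w≤k =
  ≤-trans (sum-mono-≤ λ u → sum-mono-≤ (termwise u)) (≤-reflexive (sym (*-pairCount k S)))
  where
  termwise : ∀ u v → (if R u v ∧ (toℕ u <ᵇ toℕ v) then w u v else 0) ≤
                     k * iverson (S u v ∧ (toℕ u <ᵇ toℕ v))
  termwise u v with R u v in uv
  ... | false = z≤n
  ... | true rewrite R⇒S u v uv with toℕ u <ᵇ toℕ v
  ...   | false = z≤n
  ...   | true  = ≤-trans (w≤k u v uv) (≤-reflexive (sym (*-identityʳ k)))

≤-edgeSum : ∀ {n} {R : Fin n → Fin n → Bool} {w k} →
            (∀ u v → R u v ≡ true → k ≤ w u v) → k * pairCount R ≤ edgeSum R w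
≤-edgeSum {R = R} {w} {k} k≤w =
  ≤-trans (≤-reflexive (*-pairCount k R)) (sum-mono-≤ λ u → sum-mono-≤ (termwise u))
  where
  termwise : ∀ u v → k * iverson (R u v ∧ (toℕ u <ᵇ toℕ v)) ≤
                     (if R u v ∧ (toℕ u <ᵇ toℕ v) then w u v else 0)
  termwise u v with R u v in uv
  ... | false = ≤-reflexive (*-zeroʳ k)
  ... | true with toℕ u <ᵇ toℕ v
  ...   | false = ≤-reflexive (*-zeroʳ k)
  ...   | true  = ≤-trans (≤-reflexive (*-identityʳ k)) (k≤w u v uv)

proposition2 : (n : ℕ) → 2 ≤ n → (G : Graph n) → Connected G → Bipartite G →
                 wSz G ≤ wSz (Kbal n)
proposition2 n 2≤n G _ (c , proper) = begin
  wSz G                                        ≡⟨ wSz≡edgeSum G ⟩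
  edgeSum (adj G) (edgeWeight G)               ≤⟨ edgeSum-≤ (adj⇒crosses G proper) (edgeWeight≤ G proper) ⟩
  n * M * pairCount (crosses c)                ≡⟨ cong (n * M *_) (pairCount-crosses c) ⟩
  n * M * (card c * card (not ∘ c))            ≤⟨ *-monoʳ-≤ (n * M) classes≤M ⟩
  n * M * M                                    ≡⟨ cong (n * M *_) (pairCount-Kbal n) ⟨
  n * M * pairCount (adj (Kbal n))             ≤⟨ ≤-edgeSum (edgeWeight-Kbal≥ n 2≤n) ⟩
  edgeSum (adj (Kbal n)) (edgeWeight (Kbal n)) ≡⟨ wSz≡edgeSum (Kbal n) ⟨
  wSz (Kbal n)                                 ∎
  where
  open ≤-Reasoning
  M = maxProduct n
  classes≤M : card c * card (not ∘ c) ≤ M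
  classes≤M = *-≤-maxProduct (card c) (card (not ∘ c)) (≤-reflexive (card+card-not c))
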